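{- Let $G$ be a finite abelian group and let $S\subseteq G$ with $0\in S$ be a generating subset of $G$ such that every element of $S\setminus\{0\}$ has order at least $|S|-1$. Then $\kappa_1(S)=|S|-1$. In particular, for every nonempty $X\subseteq G$, $|X+S|\ge\min\{|G|,|X|+|S|-1\}$.
   Context: For $S\subseteq G$ with $0\in S$, $\langle S\rangle$ is the subgroup generated by $S$. $S$ is $1$-separable if there exists nonempty $X\subseteq\langle S\rangle$ with $|X+S|\le|\langle S\rangle|-1$; in that case $\kappa_1(S)=\min\{|X+S|-|X| : X\subseteq\langle S\rangle,\ |X|\ge1,\ |X+S|\le|\langle S\rangle|-1\}$. If $S$ is not $1$-separable, by convention $\kappa_1(S)=|S|-1$. -}

module Defs where

open import Data.Nat using (ℕ; zero; suc; _+_; _∸_; _≤_; _<_)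
open import Data.Fin using (Fin; _≟_)
open import Data.Fin.Subset using (Subset; _∈_; _∉_; _⊆_; ∣_∣; Nonempty)
open import Data.Bool using (Bool; _∧_)
open import Data.List using (allFin)
open import Data.Bool.ListAction using (any)
open import Data.Vec using (lookup; tabulate)
open import Data.Product using (Σ; ∃; _×_; _,_)
open import Data.Sum using (_⊎_)
open import Relation.Nullary using (¬_; does)
open import Relation.Binary.PropositionalEquality using (_≡_; _≢_)
open import Algebra.Structures using (IsAbelianGroup)

-- A finite abelian group of order n, with carrier Fin n
-- (every finite abelian group is isomorphic to one of these).
record FinAbGroup (n : ℕ) : Set where
  field
    _∙_ : Fin n → Fin n → Fin n
    ε   : Fin n
    _⁻¹ : Fin n → Fin n
    isAbelianGroup : IsAbelianGroup _≡_ _∙_ ε _⁻¹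

module _ {n : ℕ} (G : FinAbGroup n) where
  open FinAbGroup G

  _·_ : ℕ → Fin n → Fin n
  zero  · g = ε
  suc k · g = g ∙ (k · g)

  sumset : Subset n → Subset n → Subset n
  sumset X S = tabulate λ g →
    any (λ x → any (λ s → lookup X x ∧ (lookup S s ∧ does ((x ∙ s) ≟ g))) (allFin n)) (allFin n)

  IsSubgroup : Subset n → Set
  IsSubgroup H = (ε ∈ H)
               × (∀ x y → x ∈ H → y ∈ H → (x ∙ y) ∈ H)
               × (∀ x → x ∈ H → (x ⁻¹) ∈ H)

  IsGeneratedBy : Subset n → Subset n → Set
  IsGeneratedBy H S = IsSubgroup H × S ⊆ H
                    × (∀ K → IsSubgroup K → S ⊆ K → H ⊆ K)

  Generates : Subset n → Set
  Generates S = ∀ K → IsSubgroup K → S ⊆ K → ∀ g → g ∈ K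

  OrderAtLeast : Fin n → ℕ → Set
  OrderAtLeast g m = ∀ k → 1 ≤ k → k < m → k · g ≢ ε

  Admissible : Subset n → Subset n → Subset n → Set
  Admissible H S X = X ⊆ H × 1 ≤ ∣ X ∣ × ∣ sumset X S ∣ ≤ ∣ H ∣ ∸ 1

  OneSeparable : Subset n → Subset n → Set
  OneSeparable H S = ∃ λ X → Admissible H S X

  Kappa1At : Subset n → Subset n → ℕ → Set
  Kappa1At H S k =
      (OneSeparable H S
        × (∃ λ X → Admissible H S X × ∣ sumset X S ∣ ∸ ∣ X ∣ ≡ k)
        × (∀ X → Admissible H S X → k ≤ ∣ sumset X S ∣ ∸ ∣ X ∣))
    ⊎ (¬ OneSeparable H S × k ≡ ∣ S ∣ ∸ 1)

  Kappa1 : Subset n → ℕ → Set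
  Kappa1 S k = ∀ H → IsGeneratedBy H S → Kappa1At H S k

{-# OPTIONS --safe #-}
module Submission where

-- Hamidoune's isoperimetric method. Let κ be the least excess |X + S| − |X| over the nonempty X
-- with X + S ≠ G, and call a set of least size attaining it an atom. The dual fragment
-- −(G ∖ (A + S)) shows 2|A| + κ ≤ |G| for an atom A, and with this, submodularity of X ↦ |X + S|
-- forces two intersecting atoms to coincide. Translates of atoms are atoms, so the atom through 0
-- is a subgroup H. If H contains some s ∈ S ∖ {0}, then |H| ≥ ord s ≥ |S| − 1, and since S
-- generates G some s′ ∈ S lies outside H, so H + S contains the coset H + s′ and κ ≥ |H|.
-- Otherwise H ∩ S = {0} and |H + S| ≥ |H ∪ S| = |H| + |S| − 1. Either way κ ≥ |S| − 1.

open import Defs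
open import Data.Nat using (ℕ; _≤_; _+_; _∸_; _⊓_)
open import Data.Fin.Subset using (Subset; _∈_; ∣_∣; Nonempty)
open import Data.Product using (_×_)
open import Relation.Binary.PropositionalEquality using (_≢_)

open import Algebra.Bundles using (AbelianGroup)
import Algebra.Properties.AbelianGroup as AbelianGroupProperties
import Algebra.Properties.CommutativeSemigroup as CommutativeSemigroupProperties
import Algebra.Properties.Group as GroupProperties
open import Data.Bool using (Bool; true; false; T; _∧_)
open import Data.Bool.Properties using (T-≡; T-∧)
open import Data.Empty using (⊥-elim)
open import Data.Fin using (Fin; _≟_)
open import Data.Fin.Permutation using (Permutation′; permutation; _⟨$⟩ʳ_)
open import Data.Fin.Properties using (any?)
open import Data.Fin.Subset using (_∉_; _⊆_; _∩_; _∪_; ∁; ⁅_⁆; ⊥; ⊤; Empty)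
open import Data.Fin.Subset.Properties
open import Data.List using (allFin)
open import Data.List.Membership.Propositional using (lose)
open import Data.List.Membership.Propositional.Properties using (∈-allFin)
open import Data.List.Relation.Unary.Any using (satisfied)
open import Data.List.Relation.Unary.Any.Properties using (any⁺; any⁻)
open import Data.Nat using (zero; suc; _<_; _<?_; _≤?_; s≤s; z<s)
open import Data.Nat.Induction using (<-wellFounded)
open import Data.Nat.Properties hiding (_≟_)
open import Algebra.Properties.CommutativeMonoid.Sum +-0-commutativeMonoid using (sum; sum-cong-≗; sum-permute)
open import Algebra.Properties.CommutativeSemigroup +-commutativeSemigroup
  using () renaming (interchange to +-interchange; x∙yz≈xz∙y to m+[n+o]≡[m+o]+n)
open import Data.Product using (∃; ∃₂; _,_; proj₁)
open import Data.Sum using (inj₁; inj₂)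
open import Data.Vec using ([]; _∷_; lookup; tabulate)
open import Data.Vec.Properties using (lookup∘tabulate; []=⇒lookup; lookup⇒[]=)
open import Function using (_∘_; _⇔_; mk⇔; Equivalence)
open import Induction.WellFounded using (Acc; acc)
open import Level using (0ℓ)
open import Relation.Binary.PropositionalEquality using (_≡_; refl; sym; trans; cong; cong₂; subst; module ≡-Reasoning)
open import Relation.Nullary using (yes; no; does; ¬_; ¬?; contradiction)
open import Relation.Nullary.Decidable using (_×-dec_; toWitness; fromWitness; isYes≗does)
open import Relation.Unary using (Pred; Decidable)

open Equivalence using (to; from)

x∈p⇔T[p[x]] : ∀ {n} {p : Subset n} {x} → x ∈ p ⇔ T (lookup p x)
x∈p⇔T[p[x]] {p = p} {x} = mk⇔ (from T-≡ ∘ []=⇒lookup) (lookup⇒[]= x p ∘ to T-≡)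

x∈tabulate⇔ : ∀ {n} {f : Fin n → Bool} {x} → x ∈ tabulate f ⇔ T (f x)
x∈tabulate⇔ {f = f} {x} = mk⇔
  (subst T (lookup∘tabulate f x) ∘ to x∈p⇔T[p[x]])
  (from x∈p⇔T[p[x]] ∘ subst T (sym (lookup∘tabulate f x)))

preimage : ∀ {n} → (Fin n → Fin n) → Subset n → Subset n
preimage f p = tabulate (lookup p ∘ f)

x∈preimage⁺ : ∀ {n} (f : Fin n → Fin n) p {x} → f x ∈ p → x ∈ preimage f p
x∈preimage⁺ f p = from x∈tabulate⇔ ∘ to x∈p⇔T[p[x]]

x∈preimage⁻ : ∀ {n} (f : Fin n → Fin n) p {x} → x ∈ preimage f p → f x ∈ p
x∈preimage⁻ f p = from x∈p⇔T[p[x]] ∘ to x∈tabulate⇔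

indicator : Bool → ℕ
indicator true  = 1
indicator false = 0

∣p∣≡∑indicator : ∀ {n} (p : Subset n) → ∣ p ∣ ≡ sum (indicator ∘ lookup p)
∣p∣≡∑indicator []          = refl
∣p∣≡∑indicator (true ∷ p)  = cong suc (∣p∣≡∑indicator p)
∣p∣≡∑indicator (false ∷ p) = ∣p∣≡∑indicator p

∣preimage∣≡∣p∣ : ∀ {n} (π : Permutation′ n) (p : Subset n) → ∣ preimage (π ⟨$⟩ʳ_) p ∣ ≡ ∣ p ∣
∣preimage∣≡∣p∣ π p = begin
  ∣ preimage (π ⟨$⟩ʳ_) p ∣                         ≡⟨ ∣p∣≡∑indicator (preimage (π ⟨$⟩ʳ_) p) ⟩
  sum (indicator ∘ lookup (preimage (π ⟨$⟩ʳ_) p))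
    ≡⟨ sum-cong-≗ (cong indicator ∘ lookup∘tabulate (lookup p ∘ (π ⟨$⟩ʳ_))) ⟩
  sum (λ i → indicator (lookup p (π ⟨$⟩ʳ i)))      ≡⟨ sum-permute (indicator ∘ lookup p) π ⟨
  sum (indicator ∘ lookup p)                       ≡⟨ ∣p∣≡∑indicator p ⟨
  ∣ p ∣                                            ∎
  where open ≡-Reasoning

∣p∩q∣+∣p∪q∣≡∣p∣+∣q∣ : ∀ {n} (p q : Subset n) → ∣ p ∩ q ∣ + ∣ p ∪ q ∣ ≡ ∣ p ∣ + ∣ q ∣
∣p∩q∣+∣p∪q∣≡∣p∣+∣q∣ []          []          = refl
∣p∩q∣+∣p∪q∣≡∣p∣+∣q∣ (true  ∷ p) (true  ∷ q) =
  cong suc (trans (+-suc _ _) (trans (cong suc (∣p∩q∣+∣p∪q∣≡∣p∣+∣q∣ p q)) (sym (+-suc _ _))))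
∣p∩q∣+∣p∪q∣≡∣p∣+∣q∣ (true  ∷ p) (false ∷ q) = trans (+-suc _ _) (cong suc (∣p∩q∣+∣p∪q∣≡∣p∣+∣q∣ p q))
∣p∩q∣+∣p∪q∣≡∣p∣+∣q∣ (false ∷ p) (true  ∷ q) =
  trans (+-suc _ _) (trans (cong suc (∣p∩q∣+∣p∪q∣≡∣p∣+∣q∣ p q)) (sym (+-suc _ _)))
∣p∩q∣+∣p∪q∣≡∣p∣+∣q∣ (false ∷ p) (false ∷ q) = ∣p∩q∣+∣p∪q∣≡∣p∣+∣q∣ p q

∣p∪q∣≡∣p∣+∣q∣ : ∀ {n} (p q : Subset n) → Empty (p ∩ q) → ∣ p ∪ q ∣ ≡ ∣ p ∣ + ∣ q ∣
∣p∪q∣≡∣p∣+∣q∣ {n} p q disjoint = begin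
  ∣ p ∪ q ∣             ≡⟨ cong (_+ ∣ p ∪ q ∣) ∣p∩q∣≡0 ⟨
  ∣ p ∩ q ∣ + ∣ p ∪ q ∣ ≡⟨ ∣p∩q∣+∣p∪q∣≡∣p∣+∣q∣ p q ⟩
  ∣ p ∣ + ∣ q ∣         ∎
  where
  open ≡-Reasoning
  ∣p∩q∣≡0 : ∣ p ∩ q ∣ ≡ 0
  ∣p∩q∣≡0 = trans (cong ∣_∣ (Empty-unique disjoint)) (∣⊥∣≡0 n)

∣∁p∣+∣p∣≡n : ∀ {n} (p : Subset n) → ∣ ∁ p ∣ + ∣ p ∣ ≡ n
∣∁p∣+∣p∣≡n p = trans (cong (_+ ∣ p ∣) (∣∁p∣≡n∸∣p∣ p)) (m∸n+n≡m (∣p∣≤n p))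

Nonempty⇒∣p∣>0 : ∀ {n} {p : Subset n} → Nonempty p → 0 < ∣ p ∣
Nonempty⇒∣p∣>0 {p = p} (x , x∈p) = subst (_≤ ∣ p ∣) (∣⁅x⁆∣≡1 x)
  (p⊆q⇒∣p∣≤∣q∣ λ y∈⁅x⁆ → subst (_∈ p) (sym (x∈⁅y⁆⇒x≡y x y∈⁅x⁆)) x∈p)

∣p∣>0⇒Nonempty : ∀ {n} {p : Subset n} → 0 < ∣ p ∣ → Nonempty p
∣p∣>0⇒Nonempty {n} {p} ∣p∣>0 with nonempty? p
... | yes p≠∅ = p≠∅
... | no  p=∅ = contradiction (trans (cong ∣_∣ (Empty-unique p=∅)) (∣⊥∣≡0 n)) (>⇒≢ ∣p∣>0)

p⊆q⇒∣q∣≤∣p∣⇒q⊆p : ∀ {n} {p q : Subset n} → p ⊆ q → ∣ q ∣ ≤ ∣ p ∣ → q ⊆ p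
p⊆q⇒∣q∣≤∣p∣⇒q⊆p {p = p} {q} p⊆q ∣q∣≤∣p∣ {x} x∈q with x ∈? p
... | yes x∈p = x∈p
... | no  x∉p = contradiction ∣q∣≤∣p∣ (<⇒≱ (p⊂q⇒∣p∣<∣q∣ (p⊆q , x , x∈q , x∉p)))

module _ {n ℓ} {P : Pred (Subset n) ℓ} (P? : Decidable P) (f : Subset n → ℕ) where

  argmin : ∀ X → P X → ∃ λ A → P A × ∀ Y → P Y → f A ≤ f Y
  argmin X = go X (<-wellFounded (f X))
    where
    go : ∀ X → Acc _<_ (f X) → P X → ∃ λ A → P A × ∀ Y → P Y → f A ≤ f Y
    go X (acc smaller) pX with anySubset? (λ Y → P? Y ×-dec (f Y <? f X))
    ... | yes (Y , pY , fY<fX) = go Y (smaller fY<fX) pY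
    ... | no  ¬∃smaller        = X , pX , λ Y pY → ≮⇒≥ (λ fY<fX → ¬∃smaller (Y , pY , fY<fX))

abelianGroup : ∀ {n} → FinAbGroup n → AbelianGroup 0ℓ 0ℓ
abelianGroup G = record { isAbelianGroup = FinAbGroup.isAbelianGroup G }

module Sumsets {n : ℕ} (G : FinAbGroup n) where

  open FinAbGroup G
  open AbelianGroup (abelianGroup G) using (identityˡ; identityʳ; group; commutativeSemigroup)
  open GroupProperties group using (⁻¹-involutive; //-rightDividesˡ; //-rightDividesʳ; \\-leftDividesʳ)
  open AbelianGroupProperties (abelianGroup G) using (⁻¹-∙-comm)
  open CommutativeSemigroupProperties commutativeSemigroup using (xy∙z≈xz∙y)

  infixl 6 _⊕_ _⊖_

  _⊕_ : Subset n → Subset n → Subset n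
  X ⊕ S = sumset G X S

  translation : Fin n → Permutation′ n
  translation t = permutation (_∙ t) (λ g → g ∙ (t ⁻¹)) (//-rightDividesˡ t) (//-rightDividesʳ t)

  inversion : Permutation′ n
  inversion = permutation _⁻¹ _⁻¹ ⁻¹-involutive ⁻¹-involutive

  _⊖_ : Subset n → Fin n → Subset n
  X ⊖ t = preimage (translation t ⟨$⟩ʳ_) X

  neg : Subset n → Subset n
  neg X = preimage (inversion ⟨$⟩ʳ_) X

  x∈X⊖t⁺ : ∀ X t {x} → x ∙ t ∈ X → x ∈ X ⊖ t
  x∈X⊖t⁺ X t = x∈preimage⁺ (translation t ⟨$⟩ʳ_) X

  x∈X⊖t⁻ : ∀ X t {x} → x ∈ X ⊖ t → x ∙ t ∈ X
  x∈X⊖t⁻ X t = x∈preimage⁻ (translation t ⟨$⟩ʳ_) X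

  x∈negX⁺ : ∀ X {x} → x ⁻¹ ∈ X → x ∈ neg X
  x∈negX⁺ = x∈preimage⁺ (inversion ⟨$⟩ʳ_)

  x∈negX⁻ : ∀ X {x} → x ∈ neg X → x ⁻¹ ∈ X
  x∈negX⁻ = x∈preimage⁻ (inversion ⟨$⟩ʳ_)

  x∈X⊕S⁺ : ∀ {X S x s} → x ∈ X → s ∈ S → x ∙ s ∈ X ⊕ S
  x∈X⊕S⁺ {X} {S} {x} {s} x∈X s∈S =
    from x∈tabulate⇔ (any⁺ _ (lose (∈-allFin x) (any⁺ _ (lose (∈-allFin s) x∙s-witness))))
    where
    x∙s-witness : T (lookup X x ∧ (lookup S s ∧ does (x ∙ s ≟ x ∙ s)))
    x∙s-witness = from T-∧ (to x∈p⇔T[p[x]] x∈X , from T-∧ (to x∈p⇔T[p[x]] s∈S ,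
      subst T (isYes≗does (x ∙ s ≟ x ∙ s)) (fromWitness refl)))

  x∈X⊕S⁻ : ∀ X S {g} → g ∈ X ⊕ S → ∃₂ λ x s → x ∈ X × s ∈ S × x ∙ s ≡ g
  x∈X⊕S⁻ X S {g} g∈X⊕S =
    let x , x-witness     = satisfied (any⁻ _ (allFin n) (to x∈tabulate⇔ g∈X⊕S))
        s , x∙s-witness   = satisfied (any⁻ _ (allFin n) x-witness)
        x∈X , s-witness   = to T-∧ x∙s-witness
        s∈S , x∙s≡g       = to T-∧ s-witness
    in x , s , from x∈p⇔T[p[x]] x∈X , from x∈p⇔T[p[x]] s∈S ,
       toWitness (subst T (sym (isYes≗does (x ∙ s ≟ g))) x∙s≡g)

  ⊕-monoˡ : ∀ {X Y} S → X ⊆ Y → X ⊕ S ⊆ Y ⊕ S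
  ⊕-monoˡ {X} S X⊆Y g∈X⊕S with x∈X⊕S⁻ X S g∈X⊕S
  ... | _ , _ , x∈X , s∈S , refl = x∈X⊕S⁺ (X⊆Y x∈X) s∈S

  X⊆X⊕S : ∀ {S} → ε ∈ S → ∀ X → X ⊆ X ⊕ S
  X⊆X⊕S {S} ε∈S X {x} x∈X = subst (_∈ X ⊕ S) (identityʳ x) (x∈X⊕S⁺ x∈X ε∈S)

  ∣X∣≤∣X⊕S∣ : ∀ {S} → ε ∈ S → ∀ X → ∣ X ∣ ≤ ∣ X ⊕ S ∣
  ∣X∣≤∣X⊕S∣ ε∈S X = p⊆q⇒∣p∣≤∣q∣ (X⊆X⊕S ε∈S X)

  ⁅ε⁆⊕S≡S : ∀ S → ⁅ ε ⁆ ⊕ S ≡ S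
  ⁅ε⁆⊕S≡S S = ⊆-antisym ⁅ε⁆⊕S⊆S S⊆⁅ε⁆⊕S
    where
    ⁅ε⁆⊕S⊆S : ⁅ ε ⁆ ⊕ S ⊆ S
    ⁅ε⁆⊕S⊆S g∈ with x∈X⊕S⁻ ⁅ ε ⁆ S g∈
    ... | x , s , x∈⁅ε⁆ , s∈S , refl =
      subst (_∈ S) (trans (sym (identityˡ s)) (cong (_∙ s) (sym (x∈⁅y⁆⇒x≡y ε x∈⁅ε⁆)))) s∈S
    S⊆⁅ε⁆⊕S : S ⊆ ⁅ ε ⁆ ⊕ S
    S⊆⁅ε⁆⊕S {s} s∈S = subst (_∈ ⁅ ε ⁆ ⊕ S) (identityˡ s) (x∈X⊕S⁺ (x∈⁅x⁆ ε) s∈S)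

  [X⊖t]⊕S⊆[X⊕S]⊖t : ∀ X S t → (X ⊖ t) ⊕ S ⊆ (X ⊕ S) ⊖ t
  [X⊖t]⊕S⊆[X⊕S]⊖t X S t g∈ with x∈X⊕S⁻ (X ⊖ t) S g∈
  ... | x , s , x∈X⊖t , s∈S , refl =
    x∈X⊖t⁺ (X ⊕ S) t (subst (_∈ X ⊕ S) (xy∙z≈xz∙y x t s) (x∈X⊕S⁺ (x∈X⊖t⁻ X t x∈X⊖t) s∈S))

  ∣X⊖t∣≡∣X∣ : ∀ X t → ∣ X ⊖ t ∣ ≡ ∣ X ∣
  ∣X⊖t∣≡∣X∣ X t = ∣preimage∣≡∣p∣ (translation t) X

  ∣negX∣≡∣X∣ : ∀ X → ∣ neg X ∣ ≡ ∣ X ∣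
  ∣negX∣≡∣X∣ = ∣preimage∣≡∣p∣ inversion

  neg∁[A⊕S]⊕S⊆neg∁A : ∀ A S → neg (∁ (A ⊕ S)) ⊕ S ⊆ neg (∁ A)
  neg∁[A⊕S]⊕S⊆neg∁A A S g∈ with x∈X⊕S⁻ (neg (∁ (A ⊕ S))) S g∈
  ... | z , s , z∈neg∁[A⊕S] , s∈S , refl = x∈negX⁺ (∁ A) (x∉p⇒x∈∁p [z∙s]⁻¹∉A)
    where
    [z∙s]⁻¹∉A : (z ∙ s) ⁻¹ ∉ A
    [z∙s]⁻¹∉A [z∙s]⁻¹∈A = x∈∁p⇒x∉p (x∈negX⁻ (∁ (A ⊕ S)) z∈neg∁[A⊕S])
      (subst (_∈ A ⊕ S) [z∙s]⁻¹∙s≡z⁻¹ (x∈X⊕S⁺ [z∙s]⁻¹∈A s∈S))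
      where
      [z∙s]⁻¹∙s≡z⁻¹ : ((z ∙ s) ⁻¹) ∙ s ≡ z ⁻¹
      [z∙s]⁻¹∙s≡z⁻¹ = trans (cong (_∙ s) (sym (⁻¹-∙-comm z s))) (//-rightDividesˡ s (z ⁻¹))

  ⊕-submodular : ∀ X Y S → ∣ (X ∩ Y) ⊕ S ∣ + ∣ (X ∪ Y) ⊕ S ∣ ≤ ∣ X ⊕ S ∣ + ∣ Y ⊕ S ∣
  ⊕-submodular X Y S = begin
    ∣ (X ∩ Y) ⊕ S ∣ + ∣ (X ∪ Y) ⊕ S ∣               ≤⟨ +-mono-≤ (p⊆q⇒∣p∣≤∣q∣ ∩⊆) (p⊆q⇒∣p∣≤∣q∣ ∪⊆) ⟩
    ∣ (X ⊕ S) ∩ (Y ⊕ S) ∣ + ∣ (X ⊕ S) ∪ (Y ⊕ S) ∣ ≡⟨ ∣p∩q∣+∣p∪q∣≡∣p∣+∣q∣ (X ⊕ S) (Y ⊕ S) ⟩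
    ∣ X ⊕ S ∣ + ∣ Y ⊕ S ∣                           ∎
    where
    open ≤-Reasoning
    ∩⊆ : (X ∩ Y) ⊕ S ⊆ (X ⊕ S) ∩ (Y ⊕ S)
    ∩⊆ g∈ = x∈p∩q⁺ (⊕-monoˡ S (p∩q⊆p X Y) g∈ , ⊕-monoˡ S (p∩q⊆q X Y) g∈)
    ∪⊆ : (X ∪ Y) ⊕ S ⊆ (X ⊕ S) ∪ (Y ⊕ S)
    ∪⊆ g∈ with x∈X⊕S⁻ (X ∪ Y) S g∈
    ... | x , s , x∈X∪Y , s∈S , refl with x∈p∪q⁻ X Y x∈X∪Y
    ...   | inj₁ x∈X = x∈p∪q⁺ (inj₁ (x∈X⊕S⁺ x∈X s∈S))
    ...   | inj₂ x∈Y = x∈p∪q⁺ (inj₂ (x∈X⊕S⁺ x∈Y s∈S))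

  subgroup-criterion : ∀ {H} → ε ∈ H → (∀ {x y} → x ∈ H → y ∈ H → y ∙ (x ⁻¹) ∈ H) → IsSubgroup G H
  subgroup-criterion {H} ε∈H y∙x⁻¹∈H = ε∈H , ∙-closed , λ _ → x⁻¹∈H
    where
    x⁻¹∈H : ∀ {x} → x ∈ H → x ⁻¹ ∈ H
    x⁻¹∈H {x} x∈H = subst (_∈ H) (identityˡ (x ⁻¹)) (y∙x⁻¹∈H x∈H ε∈H)
    ∙-closed : ∀ x y → x ∈ H → y ∈ H → x ∙ y ∈ H
    ∙-closed x y x∈H y∈H = subst (_∈ H) (cong (x ∙_) (⁻¹-involutive y)) (y∙x⁻¹∈H (x⁻¹∈H y∈H) x∈H)

  ∃generator∉subgroup : ∀ {S H} → Generates G S → IsSubgroup G H → ∣ H ∣ < n → ∃ λ s → s ∈ S × s ∉ H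
  ∃generator∉subgroup {S} {H} generates H-subgroup ∣H∣<n with any? (λ s → s ∈? S ×-dec ¬? (s ∈? H))
  ... | yes found = found
  ... | no  none  = contradiction (subst (_≤ ∣ H ∣) (∣⊤∣≡n n) (p⊆q⇒∣p∣≤∣q∣ ⊤⊆H)) (<⇒≱ ∣H∣<n)
    where
    S⊆H : S ⊆ H
    S⊆H {s} s∈S with s ∈? H
    ... | yes s∈H = s∈H
    ... | no  s∉H = contradiction (s , s∈S , s∉H) none
    ⊤⊆H : ⊤ ⊆ H
    ⊤⊆H {g} _ = generates H H-subgroup S⊆H g

  ∣H∣+∣H∣≤∣H⊕S∣ : ∀ {H S s} → IsSubgroup G H → ε ∈ S → s ∈ S → s ∉ H → ∣ H ∣ + ∣ H ∣ ≤ ∣ H ⊕ S ∣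
  ∣H∣+∣H∣≤∣H⊕S∣ {H} {S} {s} (_ , ∙-closed , ⁻¹-closed) ε∈S s∈S s∉H = begin
    ∣ H ∣ + ∣ H ∣             ≡⟨ cong (∣ H ∣ +_) (∣X⊖t∣≡∣X∣ H (s ⁻¹)) ⟨
    ∣ H ∣ + ∣ H ⊖ s ⁻¹ ∣     ≡⟨ ∣p∪q∣≡∣p∣+∣q∣ H (H ⊖ s ⁻¹) H∩[H+s]=∅ ⟨
    ∣ H ∪ (H ⊖ s ⁻¹) ∣       ≤⟨ p⊆q⇒∣p∣≤∣q∣ H∪[H+s]⊆H⊕S ⟩
    ∣ H ⊕ S ∣                 ∎
    where
    open ≤-Reasoning
    H∩[H+s]=∅ : Empty (H ∩ (H ⊖ s ⁻¹))
    H∩[H+s]=∅ (g , g∈H∩[H+s]) =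
      let g∈H , g∈H+s = x∈p∩q⁻ H (H ⊖ s ⁻¹) g∈H∩[H+s]
          s⁻¹∈H = subst (_∈ H) (\\-leftDividesʳ g (s ⁻¹))
                    (∙-closed _ _ (⁻¹-closed g g∈H) (x∈X⊖t⁻ H (s ⁻¹) g∈H+s))
      in s∉H (subst (_∈ H) (⁻¹-involutive s) (⁻¹-closed _ s⁻¹∈H))
    H∪[H+s]⊆H⊕S : H ∪ (H ⊖ s ⁻¹) ⊆ H ⊕ S
    H∪[H+s]⊆H⊕S {g} g∈ with x∈p∪q⁻ H (H ⊖ s ⁻¹) g∈
    ... | inj₁ g∈H   = X⊆X⊕S ε∈S H g∈H
    ... | inj₂ g∈H+s = subst (_∈ H ⊕ S) (//-rightDividesˡ s g) (x∈X⊕S⁺ (x∈X⊖t⁻ H (s ⁻¹) g∈H+s) s∈S)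

  ∣X∣+∣S∣≤1+∣X⊕S∣ : ∀ {X S} → ε ∈ X → ε ∈ S → X ∩ S ⊆ ⁅ ε ⁆ → ∣ X ∣ + ∣ S ∣ ≤ 1 + ∣ X ⊕ S ∣
  ∣X∣+∣S∣≤1+∣X⊕S∣ {X} {S} ε∈X ε∈S X∩S⊆⁅ε⁆ = begin
    ∣ X ∣ + ∣ S ∣             ≡⟨ ∣p∩q∣+∣p∪q∣≡∣p∣+∣q∣ X S ⟨
    ∣ X ∩ S ∣ + ∣ X ∪ S ∣     ≤⟨ +-mono-≤ ∣X∩S∣≤1 (p⊆q⇒∣p∣≤∣q∣ X∪S⊆X⊕S) ⟩
    1 + ∣ X ⊕ S ∣             ∎
    where
    open ≤-Reasoning
    ∣X∩S∣≤1 : ∣ X ∩ S ∣ ≤ 1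
    ∣X∩S∣≤1 = subst (∣ X ∩ S ∣ ≤_) (∣⁅x⁆∣≡1 ε) (p⊆q⇒∣p∣≤∣q∣ X∩S⊆⁅ε⁆)
    X∪S⊆X⊕S : X ∪ S ⊆ X ⊕ S
    X∪S⊆X⊕S g∈ with x∈p∪q⁻ X S g∈
    ... | inj₁ g∈X = X⊆X⊕S ε∈S X g∈X
    ... | inj₂ g∈S = subst (_∈ X ⊕ S) (identityˡ _) (x∈X⊕S⁺ ε∈X g∈S)

module Multiples {n : ℕ} (G : FinAbGroup n) where

  open FinAbGroup G
  open AbelianGroup (abelianGroup G) using (assoc; identityˡ; group)
  open GroupProperties group using (identityˡ-unique)

  private
    infixr 8 _·ᴳ_
    _·ᴳ_ : ℕ → Fin n → Fin n
    _·ᴳ_ = _·_ G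

  ·-homo-+ : ∀ j k g → (j + k) ·ᴳ g ≡ (j ·ᴳ g) ∙ (k ·ᴳ g)
  ·-homo-+ zero    k g = sym (identityˡ (k ·ᴳ g))
  ·-homo-+ (suc j) k g = trans (cong (g ∙_) (·-homo-+ j k g)) (sym (assoc g (j ·ᴳ g) (k ·ᴳ g)))

  ·-injective-below : ∀ {g m j k} → OrderAtLeast G g m → j < k → k < m → j ·ᴳ g ≢ k ·ᴳ g
  ·-injective-below {g} {m} {j} {k} g-order j<k k<m j·g≡k·g =
    g-order (k ∸ j) (m<n⇒0<n∸m j<k) (≤-<-trans (m∸n≤m k j) k<m) (identityˡ-unique _ _ [k∸j]·g∙j·g≡j·g)
    where
    open ≡-Reasoning
    [k∸j]·g∙j·g≡j·g : ((k ∸ j) ·ᴳ g) ∙ (j ·ᴳ g) ≡ j ·ᴳ g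
    [k∸j]·g∙j·g≡j·g = begin
      ((k ∸ j) ·ᴳ g) ∙ (j ·ᴳ g) ≡⟨ ·-homo-+ (k ∸ j) j g ⟨
      (k ∸ j + j) ·ᴳ g          ≡⟨ cong (_·ᴳ g) (m∸n+n≡m (<⇒≤ j<k)) ⟩
      k ·ᴳ g                    ≡⟨ j·g≡k·g ⟨
      j ·ᴳ g                    ∎

  multiples : ℕ → Fin n → Subset n
  multiples zero    g = ⊥
  multiples (suc k) g = multiples k g ∪ ⁅ k ·ᴳ g ⁆

  x∈multiples⁻ : ∀ k g {x} → x ∈ multiples k g → ∃ λ j → j < k × j ·ᴳ g ≡ x
  x∈multiples⁻ zero    g x∈ = ⊥-elim (∉⊥ x∈)
  x∈multiples⁻ (suc k) g x∈ with x∈p∪q⁻ (multiples k g) ⁅ k ·ᴳ g ⁆ x∈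
  ... | inj₁ x∈multiples =
    let j , j<k , j·g≡x = x∈multiples⁻ k g x∈multiples in j , m<n⇒m<1+n j<k , j·g≡x
  ... | inj₂ x∈⁅k·g⁆     = k , n<1+n k , sym (x∈⁅y⁆⇒x≡y _ x∈⁅k·g⁆)

  ∣multiples∣ : ∀ {g m} → OrderAtLeast G g m → ∀ k → k ≤ m → ∣ multiples k g ∣ ≡ k
  ∣multiples∣ g-order zero    _   = ∣⊥∣≡0 n
  ∣multiples∣ {g} g-order (suc k) k<m = begin
    ∣ multiples k g ∪ ⁅ k ·ᴳ g ⁆ ∣         ≡⟨ ∣p∪q∣≡∣p∣+∣q∣ (multiples k g) ⁅ k ·ᴳ g ⁆ disjoint ⟩
    ∣ multiples k g ∣ + ∣ ⁅ k ·ᴳ g ⁆ ∣     ≡⟨ cong₂ _+_ (∣multiples∣ g-order k (<⇒≤ k<m)) (∣⁅x⁆∣≡1 (k ·ᴳ g)) ⟩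
    k + 1                                  ≡⟨ +-comm k 1 ⟩
    suc k                                  ∎
    where
    open ≡-Reasoning
    disjoint : Empty (multiples k g ∩ ⁅ k ·ᴳ g ⁆)
    disjoint (x , x∈) =
      let x∈multiples , x∈⁅k·g⁆ = x∈p∩q⁻ (multiples k g) ⁅ k ·ᴳ g ⁆ x∈
          j , j<k , j·g≡x = x∈multiples⁻ k g x∈multiples
      in ·-injective-below g-order j<k k<m (trans j·g≡x (x∈⁅y⁆⇒x≡y _ x∈⁅k·g⁆))

  k·g∈H : ∀ {H g} → IsSubgroup G H → g ∈ H → ∀ k → k ·ᴳ g ∈ H
  k·g∈H (ε∈H , _ , _) g∈H zero = ε∈H
  k·g∈H H-subgroup@(_ , ∙-closed , _) g∈H (suc k) = ∙-closed _ _ g∈H (k·g∈H H-subgroup g∈H k)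

  order≤∣subgroup∣ : ∀ {H g m} → IsSubgroup G H → g ∈ H → OrderAtLeast G g m → m ≤ ∣ H ∣
  order≤∣subgroup∣ {H} {g} {m} H-subgroup g∈H g-order =
    subst (_≤ ∣ H ∣) (∣multiples∣ g-order m ≤-refl) (p⊆q⇒∣p∣≤∣q∣ multiples⊆H)
    where
    multiples⊆H : multiples m g ⊆ H
    multiples⊆H x∈ with x∈multiples⁻ m g x∈
    ... | j , _ , refl = k·g∈H H-subgroup g∈H j

module Atoms {n : ℕ} (G : FinAbGroup n) (S : Subset n) (ε∈S : FinAbGroup.ε G ∈ S) where

  open FinAbGroup G
  open AbelianGroup (abelianGroup G) using (identityˡ; inverseʳ)
  open Sumsets G
  open Multiples G using (order≤∣subgroup∣)

  Separating : Subset n → Set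
  Separating X = 0 < ∣ X ∣ × ∣ X ⊕ S ∣ < n

  separating? : Decidable Separating
  separating? X = 0 <? ∣ X ∣ ×-dec ∣ X ⊕ S ∣ <? n

  excess : Subset n → ℕ
  excess X = ∣ X ⊕ S ∣ ∸ ∣ X ∣

  ∣S∣>0 : 0 < ∣ S ∣
  ∣S∣>0 = Nonempty⇒∣p∣>0 (ε , ε∈S)

  LargeOrders : Set
  LargeOrders = ∀ g → g ∈ S → g ≢ ε → OrderAtLeast G g (∣ S ∣ ∸ 1)

  ∩-separating : ∀ A B → Separating A → 0 < ∣ A ∩ B ∣ → Separating (A ∩ B)
  ∩-separating A B (_ , ∣A⊕S∣<n) ∣A∩B∣>0 =
    ∣A∩B∣>0 , ≤-<-trans (p⊆q⇒∣p∣≤∣q∣ (⊕-monoˡ S (p∩q⊆p A B))) ∣A⊕S∣<n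

  module Fragments (κ : ℕ) (κ-minimal : ∀ X → Separating X → ∣ X ∣ + κ ≤ ∣ X ⊕ S ∣) where

    -- Given κ-minimal, the inequality below is in fact an equality.
    Fragment : Subset n → Set
    Fragment X = Separating X × ∣ X ⊕ S ∣ ≤ ∣ X ∣ + κ

    fragment? : Decidable Fragment
    fragment? X = separating? X ×-dec ∣ X ⊕ S ∣ ≤? ∣ X ∣ + κ

    IsAtom : Subset n → Set
    IsAtom A = Fragment A × ∀ X → Fragment X → ∣ A ∣ ≤ ∣ X ∣

    fragment-⊖ : ∀ X t → Fragment X → Fragment (X ⊖ t)
    fragment-⊖ X t ((∣X∣>0 , ∣X⊕S∣<n) , ∣X⊕S∣≤∣X∣+κ) =
      (subst (0 <_) (sym (∣X⊖t∣≡∣X∣ X t)) ∣X∣>0 , ≤-<-trans ∣[X⊖t]⊕S∣≤∣X⊕S∣ ∣X⊕S∣<n) ,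
      (begin
        ∣ (X ⊖ t) ⊕ S ∣ ≤⟨ ∣[X⊖t]⊕S∣≤∣X⊕S∣ ⟩
        ∣ X ⊕ S ∣       ≤⟨ ∣X⊕S∣≤∣X∣+κ ⟩
        ∣ X ∣ + κ       ≡⟨ cong (_+ κ) (∣X⊖t∣≡∣X∣ X t) ⟨
        ∣ X ⊖ t ∣ + κ   ∎)
      where
      open ≤-Reasoning
      ∣[X⊖t]⊕S∣≤∣X⊕S∣ : ∣ (X ⊖ t) ⊕ S ∣ ≤ ∣ X ⊕ S ∣
      ∣[X⊖t]⊕S∣≤∣X⊕S∣ = ≤-trans (p⊆q⇒∣p∣≤∣q∣ ([X⊖t]⊕S⊆[X⊕S]⊖t X S t)) (≤-reflexive (∣X⊖t∣≡∣X∣ (X ⊕ S) t))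

    atom-⊖ : ∀ A t → IsAtom A → IsAtom (A ⊖ t)
    atom-⊖ A t (A-fragment , A-minimal) =
      fragment-⊖ A t A-fragment ,
      λ X X-fragment → subst (_≤ ∣ X ∣) (sym (∣X⊖t∣≡∣X∣ A t)) (A-minimal X X-fragment)

    ∃dual-fragment : ∀ A → Fragment A → ∃ λ Z → Fragment Z × ∣ Z ∣ + ∣ A ⊕ S ∣ ≡ n
    ∃dual-fragment A ((∣A∣>0 , ∣A⊕S∣<n) , ∣A⊕S∣≤∣A∣+κ) =
      Z , ((∣Z∣>0 , ∣Z⊕S∣<n) , ∣Z⊕S∣≤∣Z∣+κ) , ∣Z∣+∣A⊕S∣≡n
      where
      open ≤-Reasoning
      Z : Subset n
      Z = neg (∁ (A ⊕ S))
      ∣Z∣+∣A⊕S∣≡n : ∣ Z ∣ + ∣ A ⊕ S ∣ ≡ n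
      ∣Z∣+∣A⊕S∣≡n = trans (cong (_+ ∣ A ⊕ S ∣) (∣negX∣≡∣X∣ (∁ (A ⊕ S)))) (∣∁p∣+∣p∣≡n (A ⊕ S))
      ∣Z⊕S∣+∣A∣≤n : ∣ Z ⊕ S ∣ + ∣ A ∣ ≤ n
      ∣Z⊕S∣+∣A∣≤n = begin
        ∣ Z ⊕ S ∣ + ∣ A ∣     ≤⟨ +-monoˡ-≤ ∣ A ∣ (p⊆q⇒∣p∣≤∣q∣ (neg∁[A⊕S]⊕S⊆neg∁A A S)) ⟩
        ∣ neg (∁ A) ∣ + ∣ A ∣ ≡⟨ cong (_+ ∣ A ∣) (∣negX∣≡∣X∣ (∁ A)) ⟩
        ∣ ∁ A ∣ + ∣ A ∣       ≡⟨ ∣∁p∣+∣p∣≡n A ⟩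
        n                     ∎
      ∣Z∣>0 : 0 < ∣ Z ∣
      ∣Z∣>0 = +-cancelʳ-< ∣ A ⊕ S ∣ 0 (∣ Z ∣) (subst (∣ A ⊕ S ∣ <_) (sym ∣Z∣+∣A⊕S∣≡n) ∣A⊕S∣<n)
      ∣Z⊕S∣<n : ∣ Z ⊕ S ∣ < n
      ∣Z⊕S∣<n = <-≤-trans (m<m+n ∣ Z ⊕ S ∣ ∣A∣>0) ∣Z⊕S∣+∣A∣≤n
      ∣Z⊕S∣≤∣Z∣+κ : ∣ Z ⊕ S ∣ ≤ ∣ Z ∣ + κ
      ∣Z⊕S∣≤∣Z∣+κ = +-cancelʳ-≤ ∣ A ∣ _ _ (begin
        ∣ Z ⊕ S ∣ + ∣ A ∣   ≤⟨ ∣Z⊕S∣+∣A∣≤n ⟩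
        n                   ≡⟨ ∣Z∣+∣A⊕S∣≡n ⟨
        ∣ Z ∣ + ∣ A ⊕ S ∣   ≤⟨ +-monoʳ-≤ ∣ Z ∣ ∣A⊕S∣≤∣A∣+κ ⟩
        ∣ Z ∣ + (∣ A ∣ + κ) ≡⟨ m+[n+o]≡[m+o]+n (∣ Z ∣) (∣ A ∣) κ ⟩
        ∣ Z ∣ + κ + ∣ A ∣   ∎)

    atom-size-bound : ∀ A → IsAtom A → ∣ A ∣ + (∣ A ∣ + κ) ≤ n
    atom-size-bound A (A-fragment , A-minimal) =
      let Z , Z-fragment , ∣Z∣+∣A⊕S∣≡n = ∃dual-fragment A A-fragment
      in begin
        ∣ A ∣ + (∣ A ∣ + κ) ≤⟨ +-mono-≤ (A-minimal Z Z-fragment) (κ-minimal A (proj₁ A-fragment)) ⟩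
        ∣ Z ∣ + ∣ A ⊕ S ∣   ≡⟨ ∣Z∣+∣A⊕S∣≡n ⟩
        n                   ∎
      where open ≤-Reasoning

    atoms-same-size : ∀ A B → IsAtom A → IsAtom B → ∣ A ∣ ≡ ∣ B ∣
    atoms-same-size A B (A-fragment , A-minimal) (B-fragment , B-minimal) =
      ≤-antisym (A-minimal B B-fragment) (B-minimal A A-fragment)

    ⊕-submodular-fragments : ∀ A B → Fragment A → Fragment B →
      ∣ (A ∩ B) ⊕ S ∣ + ∣ (A ∪ B) ⊕ S ∣ ≤ (∣ A ∩ B ∣ + κ) + (∣ A ∪ B ∣ + κ)
    ⊕-submodular-fragments A B (_ , ∣A⊕S∣≤∣A∣+κ) (_ , ∣B⊕S∣≤∣B∣+κ) = begin
      ∣ (A ∩ B) ⊕ S ∣ + ∣ (A ∪ B) ⊕ S ∣   ≤⟨ ⊕-submodular A B S ⟩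
      ∣ A ⊕ S ∣ + ∣ B ⊕ S ∣               ≤⟨ +-mono-≤ ∣A⊕S∣≤∣A∣+κ ∣B⊕S∣≤∣B∣+κ ⟩
      (∣ A ∣ + κ) + (∣ B ∣ + κ)           ≡⟨ +-interchange (∣ A ∣) κ (∣ B ∣) κ ⟩
      (∣ A ∣ + ∣ B ∣) + (κ + κ)           ≡⟨ cong (_+ (κ + κ)) (∣p∩q∣+∣p∪q∣≡∣p∣+∣q∣ A B) ⟨
      (∣ A ∩ B ∣ + ∣ A ∪ B ∣) + (κ + κ)   ≡⟨ +-interchange (∣ A ∩ B ∣) κ (∣ A ∪ B ∣) κ ⟨
      (∣ A ∩ B ∣ + κ) + (∣ A ∪ B ∣ + κ)   ∎
      where open ≤-Reasoning

    ∪-separating : ∀ A B → IsAtom A → IsAtom B → 0 < ∣ A ∩ B ∣ → Separating (A ∪ B)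
    ∪-separating A B A-atom@((A-separating@(∣A∣>0 , _) , _) , _) B-atom ∣A∩B∣>0 with ∣ (A ∪ B) ⊕ S ∣ <? n
    ... | yes ∣A∪B⊕S∣<n = <-≤-trans ∣A∣>0 (∣p∣≤∣p∪q∣ A B) , ∣A∪B⊕S∣<n
    ... | no  ∣A∪B⊕S∣≮n = contradiction n<n (<-irrefl refl)
      where
      open ≤-Reasoning
      n≤∣A∪B∣+κ : n ≤ ∣ A ∪ B ∣ + κ
      n≤∣A∪B∣+κ = +-cancelˡ-≤ (∣ A ∩ B ∣ + κ) n (∣ A ∪ B ∣ + κ) (begin
        (∣ A ∩ B ∣ + κ) + n                 ≤⟨ +-mono-≤ (κ-minimal (A ∩ B) (∩-separating A B A-separating ∣A∩B∣>0))
                                                             (≮⇒≥ ∣A∪B⊕S∣≮n) ⟩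
        ∣ (A ∩ B) ⊕ S ∣ + ∣ (A ∪ B) ⊕ S ∣   ≤⟨ ⊕-submodular-fragments A B (proj₁ A-atom) (proj₁ B-atom) ⟩
        (∣ A ∩ B ∣ + κ) + (∣ A ∪ B ∣ + κ)   ∎)
      ∣A∪B∣<∣A∣+∣A∣ : ∣ A ∪ B ∣ < ∣ A ∣ + ∣ A ∣
      ∣A∪B∣<∣A∣+∣A∣ = begin-strict
        ∣ A ∪ B ∣             <⟨ m<n+m ∣ A ∪ B ∣ ∣A∩B∣>0 ⟩
        ∣ A ∩ B ∣ + ∣ A ∪ B ∣ ≡⟨ ∣p∩q∣+∣p∪q∣≡∣p∣+∣q∣ A B ⟩
        ∣ A ∣ + ∣ B ∣         ≡⟨ cong (∣ A ∣ +_) (atoms-same-size A B A-atom B-atom) ⟨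
        ∣ A ∣ + ∣ A ∣         ∎
      n<n : n < n
      n<n = begin-strict
        n                     ≤⟨ n≤∣A∪B∣+κ ⟩
        ∣ A ∪ B ∣ + κ         <⟨ +-monoˡ-< κ ∣A∪B∣<∣A∣+∣A∣ ⟩
        ∣ A ∣ + ∣ A ∣ + κ     ≡⟨ +-assoc (∣ A ∣) (∣ A ∣) κ ⟩
        ∣ A ∣ + (∣ A ∣ + κ)   ≤⟨ atom-size-bound A A-atom ⟩
        n                     ∎

    ∩-fragment : ∀ A B → Fragment A → Fragment B → Separating (A ∩ B) → Separating (A ∪ B) → Fragment (A ∩ B)
    ∩-fragment A B A-fragment B-fragment A∩B-separating A∪B-separating =
      A∩B-separating , +-cancelʳ-≤ (∣ A ∪ B ∣ + κ) (∣ (A ∩ B) ⊕ S ∣) (∣ A ∩ B ∣ + κ) (begin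
        ∣ (A ∩ B) ⊕ S ∣ + (∣ A ∪ B ∣ + κ)   ≤⟨ +-monoʳ-≤ ∣ (A ∩ B) ⊕ S ∣ (κ-minimal (A ∪ B) A∪B-separating) ⟩
        ∣ (A ∩ B) ⊕ S ∣ + ∣ (A ∪ B) ⊕ S ∣   ≤⟨ ⊕-submodular-fragments A B A-fragment B-fragment ⟩
        (∣ A ∩ B ∣ + κ) + (∣ A ∪ B ∣ + κ)   ∎)
      where open ≤-Reasoning

    atoms-meet⇒⊆ : ∀ A B → IsAtom A → IsAtom B → 0 < ∣ A ∩ B ∣ → A ⊆ B
    atoms-meet⇒⊆ A B A-atom@(A-fragment , A-minimal) B-atom@(B-fragment , _) ∣A∩B∣>0 =
      p∩q⊆q A B ∘ p⊆q⇒∣q∣≤∣p∣⇒q⊆p (p∩q⊆p A B) (A-minimal (A ∩ B) A∩B-fragment)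
      where
      A∩B-fragment : Fragment (A ∩ B)
      A∩B-fragment = ∩-fragment A B A-fragment B-fragment
        (∩-separating A B (proj₁ A-fragment) ∣A∩B∣>0) (∪-separating A B A-atom B-atom ∣A∩B∣>0)

    atom∋ε⇒subgroup : ∀ A → IsAtom A → ε ∈ A → IsSubgroup G A
    atom∋ε⇒subgroup A A-atom ε∈A = subgroup-criterion ε∈A y∙x⁻¹∈A
      where
      y∙x⁻¹∈A : ∀ {x y} → x ∈ A → y ∈ A → y ∙ (x ⁻¹) ∈ A
      y∙x⁻¹∈A {x} x∈A y∈A =
        x∈X⊖t⁻ A (x ⁻¹) (atoms-meet⇒⊆ A (A ⊖ x ⁻¹) A-atom (atom-⊖ A (x ⁻¹) A-atom) ∣A∩[A+x]∣>0 y∈A)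
        where
        x∈A+x : x ∈ A ⊖ x ⁻¹
        x∈A+x = x∈X⊖t⁺ A (x ⁻¹) (subst (_∈ A) (sym (inverseʳ x)) ε∈A)
        ∣A∩[A+x]∣>0 : 0 < ∣ A ∩ (A ⊖ x ⁻¹) ∣
        ∣A∩[A+x]∣>0 = Nonempty⇒∣p∣>0 (x , x∈p∩q⁺ (x∈A , x∈A+x))

    subgroup-atom⇒∣S∣∸1≤κ : Generates G S → LargeOrders → ∀ H → IsAtom H → ε ∈ H → ∣ S ∣ ∸ 1 ≤ κ
    subgroup-atom⇒∣S∣∸1≤κ generates large-orders H H-atom@(((_ , ∣H⊕S∣<n) , ∣H⊕S∣≤∣H∣+κ) , _) ε∈H
      with any? (λ s → s ∈? H ∩ S ×-dec ¬? (s ≟ ε))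
    ... | yes (s , s∈H∩S , s≢ε) =
      let s∈H , s∈S = x∈p∩q⁻ H S s∈H∩S
      in ≤-trans (order≤∣subgroup∣ H-subgroup s∈H (large-orders s s∈S s≢ε)) ∣H∣≤κ
      where
      H-subgroup : IsSubgroup G H
      H-subgroup = atom∋ε⇒subgroup H H-atom ε∈H
      ∣H∣≤κ : ∣ H ∣ ≤ κ
      ∣H∣≤κ =
        let s′ , s′∈S , s′∉H = ∃generator∉subgroup generates H-subgroup (≤-<-trans (∣X∣≤∣X⊕S∣ ε∈S H) ∣H⊕S∣<n)
        in +-cancelˡ-≤ ∣ H ∣ _ _ (≤-trans (∣H∣+∣H∣≤∣H⊕S∣ H-subgroup ε∈S s′∈S s′∉H) ∣H⊕S∣≤∣H∣+κ)
    ... | no  ∄s = ∸-monoˡ-≤ 1 (+-cancelˡ-≤ ∣ H ∣ _ _ (begin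
        ∣ H ∣ + ∣ S ∣         ≤⟨ ∣X∣+∣S∣≤1+∣X⊕S∣ ε∈H ε∈S H∩S⊆⁅ε⁆ ⟩
        suc ∣ H ⊕ S ∣         ≤⟨ s≤s ∣H⊕S∣≤∣H∣+κ ⟩
        suc (∣ H ∣ + κ)       ≡⟨ +-suc ∣ H ∣ κ ⟨
        ∣ H ∣ + suc κ         ∎))
      where
      open ≤-Reasoning
      H∩S⊆⁅ε⁆ : H ∩ S ⊆ ⁅ ε ⁆
      H∩S⊆⁅ε⁆ {g} g∈H∩S with g ≟ ε
      ... | yes refl = x∈⁅x⁆ ε
      ... | no  g≢ε  = contradiction (g , g∈H∩S , g≢ε) ∄s

    fragment⇒∣S∣∸1≤κ : Generates G S → LargeOrders → ∀ X → Fragment X → ∣ S ∣ ∸ 1 ≤ κ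
    fragment⇒∣S∣∸1≤κ generates large-orders X X-fragment =
      let A , A-atom = argmin fragment? ∣_∣ X X-fragment
          a , a∈A    = ∣p∣>0⇒Nonempty (proj₁ (proj₁ (proj₁ A-atom)))
          ε∈A-a      = x∈X⊖t⁺ A a (subst (_∈ A) (sym (identityˡ a)) a∈A)
      in subgroup-atom⇒∣S∣∸1≤κ generates large-orders (A ⊖ a) (atom-⊖ A a A-atom) ε∈A-a

  separating-bound : Generates G S → LargeOrders → ∀ X → Separating X → ∣ X ∣ + (∣ S ∣ ∸ 1) ≤ ∣ X ⊕ S ∣
  separating-bound generates large-orders X X-separating with argmin separating? excess X X-separating
  ... | A , A-separating , A-minimal =
    ≤-trans (+-monoʳ-≤ ∣ X ∣ (fragment⇒∣S∣∸1≤κ generates large-orders A A-fragment)) (κ-minimal X X-separating)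
    where
    κ : ℕ
    κ = excess A
    κ-minimal : ∀ Y → Separating Y → ∣ Y ∣ + κ ≤ ∣ Y ⊕ S ∣
    κ-minimal Y Y-separating =
      subst (∣ Y ∣ + κ ≤_) (m+[n∸m]≡n (∣X∣≤∣X⊕S∣ ε∈S Y)) (+-monoʳ-≤ ∣ Y ∣ (A-minimal Y Y-separating))
    open Fragments κ κ-minimal
    A-fragment : Fragment A
    A-fragment = A-separating , ≤-reflexive (sym (m+[n∸m]≡n (∣X∣≤∣X⊕S∣ ε∈S A)))

  module _ {H : Subset n} (H-whole : ∀ g → g ∈ H) where

    private
      ∣H∣≡n : ∣ H ∣ ≡ n
      ∣H∣≡n = ≤-antisym (∣p∣≤n H) (subst (_≤ ∣ H ∣) (∣⊤∣≡n n) (p⊆q⇒∣p∣≤∣q∣ {p = ⊤} (λ {g} _ → H-whole g)))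

    separating⇒admissible : ∀ X → Separating X → Admissible G H S X
    separating⇒admissible X (∣X∣>0 , ∣X⊕S∣<n) =
      (λ {x} _ → H-whole x) , ∣X∣>0 , subst (λ h → ∣ X ⊕ S ∣ ≤ h ∸ 1) (sym ∣H∣≡n) (∸-monoˡ-≤ 1 ∣X⊕S∣<n)

    admissible⇒separating : ∀ X → Admissible G H S X → Separating X
    admissible⇒separating X (_ , ∣X∣>0 , ∣X⊕S∣≤∣H∣∸1) =
      ∣X∣>0 , subst (∣ X ⊕ S ∣ <_) (m+[n∸m]≡n n>0) (s≤s (subst (λ h → ∣ X ⊕ S ∣ ≤ h ∸ 1) ∣H∣≡n ∣X⊕S∣≤∣H∣∸1))
      where
      n>0 : 0 < n
      n>0 = <-≤-trans ∣X∣>0 (∣p∣≤n X)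

    κ₁≡∣S∣∸1 : Generates G S → LargeOrders → Kappa1At G H S (∣ S ∣ ∸ 1)
    κ₁≡∣S∣∸1 generates large-orders with ∣ S ∣ <? n
    ... | yes ∣S∣<n =
      inj₁ ((⁅ ε ⁆ , ⁅ε⁆-admissible) , (⁅ ε ⁆ , ⁅ε⁆-admissible , excess⁅ε⁆≡∣S∣∸1) , ∣S∣∸1≤excess)
      where
      ⁅ε⁆-admissible : Admissible G H S ⁅ ε ⁆
      ⁅ε⁆-admissible = separating⇒admissible ⁅ ε ⁆
        (subst (0 <_) (sym (∣⁅x⁆∣≡1 ε)) z<s , subst (_< n) (sym (cong ∣_∣ (⁅ε⁆⊕S≡S S))) ∣S∣<n)
      excess⁅ε⁆≡∣S∣∸1 : excess ⁅ ε ⁆ ≡ ∣ S ∣ ∸ 1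
      excess⁅ε⁆≡∣S∣∸1 = cong₂ _∸_ (cong ∣_∣ (⁅ε⁆⊕S≡S S)) (∣⁅x⁆∣≡1 ε)
      ∣S∣∸1≤excess : ∀ X → Admissible G H S X → ∣ S ∣ ∸ 1 ≤ excess X
      ∣S∣∸1≤excess X X-admissible = m+n≤o⇒m≤o∸n (∣ S ∣ ∸ 1) (subst (_≤ ∣ X ⊕ S ∣) (+-comm ∣ X ∣ _)
        (separating-bound generates large-orders X (admissible⇒separating X X-admissible)))
    ... | no  ∣S∣≮n = inj₂ (not-separable , refl)
      where
      not-separable : ¬ OneSeparable G H S
      not-separable (X , X-admissible) with admissible⇒separating X X-admissible
      ... | X-separating@(∣X∣>0 , ∣X⊕S∣<n) = ∣S∣≮n (begin-strict
        ∣ S ∣                 ≡⟨ m+[n∸m]≡n ∣S∣>0 ⟨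
        1 + (∣ S ∣ ∸ 1)       ≤⟨ +-monoˡ-≤ (∣ S ∣ ∸ 1) ∣X∣>0 ⟩
        ∣ X ∣ + (∣ S ∣ ∸ 1)   ≤⟨ separating-bound generates large-orders X X-separating ⟩
        ∣ X ⊕ S ∣             <⟨ ∣X⊕S∣<n ⟩
        n                     ∎)
        where open ≤-Reasoning

  sumset-bound : Generates G S → LargeOrders → ∀ X → Nonempty X → n ⊓ (∣ X ∣ + ∣ S ∣ ∸ 1) ≤ ∣ X ⊕ S ∣
  sumset-bound generates large-orders X X≢∅ with ∣ X ⊕ S ∣ <? n
  ... | yes ∣X⊕S∣<n = ≤-trans (m⊓n≤n n _) (subst (_≤ ∣ X ⊕ S ∣) (sym (+-∸-assoc ∣ X ∣ ∣S∣>0))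
    (separating-bound generates large-orders X (Nonempty⇒∣p∣>0 X≢∅ , ∣X⊕S∣<n)))
  ... | no  ∣X⊕S∣≮n = ≤-trans (m⊓n≤m n _) (≮⇒≥ ∣X⊕S∣≮n)

corollary2p5 : ∀ {n : ℕ} (G : FinAbGroup n) (S : Subset n)
    → FinAbGroup.ε G ∈ S
    → Generates G S
    → (∀ g → g ∈ S → g ≢ FinAbGroup.ε G → OrderAtLeast G g (∣ S ∣ ∸ 1))
    → Kappa1 G S (∣ S ∣ ∸ 1)
      × (∀ (X : Subset n) → Nonempty X → n ⊓ (∣ X ∣ + ∣ S ∣ ∸ 1) ≤ ∣ sumset G X S ∣)
corollary2p5 G S ε∈S generates large-orders =
  (λ H (H-subgroup , S⊆H , _) → κ₁≡∣S∣∸1 (generates H H-subgroup S⊆H) generates large-orders) ,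
  sumset-bound generates large-orders
  where open Atoms G S ε∈S
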